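{- Let $k\ge1$ and let ${\cal F} \subseteq 2^\omega$ satisfy: for every countable set $\Psi$ of functions $\bigcup_i 2^{ik} \to 2^k$ there is $g \in {\cal F}$ such that for every $\psi\in\Psi$ there are infinitely many $i$ with $\psi (g{\upharpoonright} ik) = g {\upharpoonright} [ik , (i+1) k)$. Then ${\mathfrak e}_2^{\mathrm{const}} (k) \leq |{\cal F}|$.
   Context: $2^k$ denotes the set of $0$–$1$ sequences of length $k$; $g{\upharpoonright}[ik,(i+1)k)$ is the element of $2^k$ given by $m\mapsto g(ik+m)$. A predictor is a function $\pi:2^{<\omega}\to 2$; it $k$--constantly predicts $x\in2^\omega$ if for all but finitely many intervals $I=\{a,\dots,a+k-1\}$ of length $k$ there is $i\in I$ with $x(i)=\pi(x{\upharpoonright} i)$. ${\mathfrak e}_2^{\mathrm{const}}(k)$ is the least size of a set $F\subseteq 2^\omega$ such that for every predictor $\pi$ some $x\in F$ is not $k$--constantly predicted by $\pi$. -}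

module Defs where

open import Data.Nat using (ℕ; _+_; _*_; _≤_; _<_)
open import Data.Bool using (Bool)
open import Data.Fin using (Fin; toℕ)
open import Data.Vec using (Vec)
import Data.Vec as Vec
open import Data.List using (List)
import Data.List as List
open import Data.Product using (Σ; ∃; ∃-syntax; _×_)
open import Data.Empty using (⊥)
open import Relation.Nullary using (¬_)
open import Relation.Binary.PropositionalEquality using (_≡_)

Seq : Set
Seq = ℕ → Bool

SetOfSeq : Set₁
SetOfSeq = Seq → Set

_↾_ : Seq → ℕ → List Bool
x ↾ n = List.tabulate {n = n} (λ j → x (toℕ j))

restrictV : Seq → (n : ℕ) → Vec Bool n
restrictV g n = Vec.tabulate (λ j → g (toℕ j))

block : (k : ℕ) → Seq → (i : ℕ) → Vec Bool k
block k g i = Vec.tabulate (λ m → g (i * k + toℕ m))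

Predictor : Set
Predictor = List Bool → Bool

KConstPredicts : ℕ → Predictor → Seq → Set
KConstPredicts k π x =
  ∃[ N ] ∀ a → N ≤ a → ∃[ i ] (a ≤ i × i < a + k × x i ≡ π (x ↾ i))

IsConstWitness : ℕ → SetOfSeq → Set
IsConstWitness k F = ∀ (π : Predictor) → ∃[ x ] (F x × ¬ KConstPredicts k π x)

_≈ₛ_ : Seq → Seq → Set
x ≈ₛ y = ∀ n → x n ≡ y n

-- |F'| ≤ |F| : an injection from F' into F (w.r.t. equality of sequences)
CardLe : SetOfSeq → SetOfSeq → Set
CardLe F' F =
  Σ (Σ Seq F' → Σ Seq F) λ h →
    ∀ (a b : Σ Seq F') → Σ.proj₁ (h a) ≈ₛ Σ.proj₁ (h b) → Σ.proj₁ a ≈ₛ Σ.proj₁ b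

-- e_2^const(k) ≤ |F| : some witness family F' has |F'| ≤ |F|
-- (e_2^const(k) is the least size of a witness family)
EConstLe : ℕ → SetOfSeq → Set₁
EConstLe k F = Σ SetOfSeq λ F' → IsConstWitness k F' × CardLe F' F

-- functions ⋃_i 2^{ik} → 2^k (for k ≥ 1 the 2^{ik} are disjoint, so we index by i)
BlockFun : ℕ → Set
BlockFun k = (i : ℕ) → Vec Bool (i * k) → Vec Bool k

-- hypothesis on F: for every countable Ψ (enumerated as ψ₀, ψ₁, …) there is g ∈ F
-- such that every ψ ∈ Ψ guesses the k-block of g correctly infinitely often
BlockHyp : (k : ℕ) → SetOfSeq → Set
BlockHyp k F =
  ∀ (Ψ : ℕ → BlockFun k) → ∃[ g ] (F g × (∀ n N → ∃[ i ] (N ≤ i × Ψ n i (restrictV g (i * k)) ≡ block k g i)))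

module Submission where

open import Defs
open import Data.Nat using (ℕ; _≥_; zero; suc; _+_; _*_; _≤_; _<_; _∸_; >-nonZero)
open import Data.Nat.Properties using (+-identityʳ; +-suc; ≤-refl; ≤-trans; <-trans; m<n⇒m<1+n; m≤m*n; m+[n∸m]≡n; +-cancelˡ-<)
open import Data.Bool using (Bool; not)
open import Data.Bool.Properties using (not-¬)
open import Data.Fin using (toℕ; fromℕ<)
open import Data.Fin.Properties using (toℕ-fromℕ<)
import Data.Vec as Vec
open import Data.Vec.Properties using (lookup∘tabulate)
open import Data.List using (List; _++_; [_]; _∷_)
open import Data.Product using (_,_)
open import Relation.Nullary using (¬_)
open import Relation.Binary.PropositionalEquality using (_≡_; _≢_; refl; sym; trans; cong; cong₂; subst; module ≡-Reasoning)

-- Given π, let ψ fill a block by always answering the opposite of what π predicts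
-- from the prefix built so far.  Whenever ψ guesses the i-th block of g correctly,
-- π errs at every position of that block, i.e. on the length-k interval starting
-- at ik.  The hypothesis on F, applied to Ψ = {ψ}, yields g ∈ F for which this
-- happens for arbitrarily large i, so g is not k-constantly predicted by π and
-- F itself witnesses e₂ᶜᵒⁿˢᵗ(k) ≤ |F|.

↾-suc : ∀ (x : Seq) n → x ↾ suc n ≡ x ↾ n ++ [ x n ]
↾-suc x zero    = refl
↾-suc x (suc n) = cong (x 0 ∷_) (↾-suc (λ j → x (suc j)) n)

toList-restrictV : ∀ (x : Seq) n → Vec.toList (restrictV x n) ≡ x ↾ n
toList-restrictV x zero    = refl
toList-restrictV x (suc n) = cong (x 0 ∷_) (toList-restrictV (λ j → x (suc j)) n)

module Evasion (π : Predictor) where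

  evade : List Bool → ℕ → List Bool
  evade l zero    = l
  evade l (suc m) = evade l m ++ [ not (π (evade l m)) ]

  evadingBlock : (k : ℕ) → BlockFun k
  evadingBlock k i σ = Vec.tabulate (λ m → not (π (evade (Vec.toList σ) (toℕ m))))

  ↾-evade : ∀ (g : Seq) a m → (∀ j → j < m → g (a + j) ≡ not (π (evade (g ↾ a) j))) →
            g ↾ (a + m) ≡ evade (g ↾ a) m
  ↾-evade g a zero    _       rewrite +-identityʳ a = refl
  ↾-evade g a (suc m) follows rewrite +-suc a m =
    trans (↾-suc g (a + m))
          (cong₂ _++_ (↾-evade g a m (λ j j<m → follows j (m<n⇒m<1+n j<m)))
                      (cong [_] (follows m ≤-refl)))

  module _ {k : ℕ} {g : Seq} {i : ℕ}
           (guessed : evadingBlock k i (restrictV g (i * k)) ≡ block k g i) where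

    evadingBlock-bits : ∀ j → j < k → g (i * k + j) ≡ not (π (evade (g ↾ (i * k)) j))
    evadingBlock-bits j j<k = begin
      g (i * k + j)                                                    ≡⟨ cong (λ t → g (i * k + t)) (toℕ-fromℕ< j<k) ⟨
      g (i * k + toℕ m)                                                ≡⟨ lookup∘tabulate _ m ⟨
      Vec.lookup (block k g i) m                                       ≡⟨ cong (λ v → Vec.lookup v m) guessed ⟨
      Vec.lookup (evadingBlock k i (restrictV g (i * k))) m            ≡⟨ lookup∘tabulate _ m ⟩
      not (π (evade (Vec.toList (restrictV g (i * k))) (toℕ m)))       ≡⟨ cong (λ l → not (π (evade l (toℕ m)))) (toList-restrictV g (i * k)) ⟩
      not (π (evade (g ↾ (i * k)) (toℕ m)))                            ≡⟨ cong (λ t → not (π (evade (g ↾ (i * k)) t))) (toℕ-fromℕ< j<k) ⟩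
      not (π (evade (g ↾ (i * k)) j))                                  ∎
      where
      open ≡-Reasoning
      m = fromℕ< j<k

    evadingBlock-unpredicted : ∀ j → i * k ≤ j → j < i * k + k → g j ≢ π (g ↾ j)
    evadingBlock-unpredicted j ik≤j j<ik+k = subst (λ t → g t ≢ π (g ↾ t)) split (λ hit → not-¬ refl (trans (sym hit) bit))
      where
      m = j ∸ i * k
      split : i * k + m ≡ j
      split = m+[n∸m]≡n ik≤j
      m<k : m < k
      m<k = +-cancelˡ-< (i * k) m k (subst (_< i * k + k) (sym split) j<ik+k)
      bit : g (i * k + m) ≡ not (π (g ↾ (i * k + m)))
      bit = trans (evadingBlock-bits m m<k)
                  (cong (λ l → not (π l))
                        (sym (↾-evade g (i * k) m (λ j′ j′<m → evadingBlock-bits j′ (<-trans j′<m m<k)))))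

open Evasion

blockHyp⇒constWitness : ∀ {k} → k ≥ 1 → (F : SetOfSeq) → BlockHyp k F → IsConstWitness k F
blockHyp⇒constWitness {k} k≥1 F hyp π with hyp (λ _ → evadingBlock π k)
... | g , g∈F , guessedOften = g , g∈F , unpredicted
  where
  unpredicted : ¬ KConstPredicts k π g
  unpredicted (N , predicted) =
    let (i , N≤i , guessed) = guessedOften 0 N
        (j , ik≤j , j<ik+k , hit) = predicted (i * k) (≤-trans N≤i (m≤m*n i k {{>-nonZero k≥1}}))
    in evadingBlock-unpredicted π {k} {g} {i} guessed j ik≤j j<ik+k hit

CardLe-refl : (F : SetOfSeq) → CardLe F F
CardLe-refl F = (λ a → a) , (λ _ _ e → e)

lemma3p4 : (k : ℕ) → k ≥ 1 → (F : SetOfSeq) → BlockHyp k F → EConstLe k F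
lemma3p4 k k≥1 F hyp = F , blockHyp⇒constWitness k≥1 F hyp , CardLe-refl F
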